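{- Let $A$ be a threshold graph with $|V(A)|>1$. Then a vertex $t\in V(A)$ is $A$-terminal if and only if $t$ is not $\overline{A}$-terminal. Consequently every two $A$-terminal vertices are nonadjacent in $A$, and every two $A$-non-terminal vertices are adjacent in $A$.
   Context: A threshold graph is a graph with no induced four-vertex path, four-vertex cycle, or two-edge matching. $\overline{A}$ is the complement of $A$. In a graph $H$, $u$ $H$-dominates $v$ if $u,v$ are adjacent and every neighbour of $v$ is equal or adjacent to $u$. A vertex $t$ is $H$-non-terminal if there exists $s\in V(H)\setminus\{t\}$ such that $t$ $H$-dominates $s$, and $H$-terminal otherwise. -}

module Defs where

open import Data.Nat using (ℕ; _>_)
open import Data.Fin using (Fin)
open import Data.Product using (Σ; _×_; _,_; ∃-syntax)
open import Data.Sum using (_⊎_)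
open import Relation.Nullary using (¬_; Dec)
open import Relation.Binary.PropositionalEquality using (_≡_; _≢_; refl)
open import Level using (0ℓ)
open import Relation.Binary.Core using (Rel)

record Graph (n : ℕ) : Set₁ where
  field
    Adj     : Rel (Fin n) 0ℓ
    adj?    : (u v : Fin n) → Dec (Adj u v)
    irrefl  : ∀ {u} → ¬ Adj u u
    sym     : ∀ {u v} → Adj u v → Adj v u
open Graph public

complement : ∀ {n} → Graph n → Graph n
complement G = record
  { Adj    = λ u v → (u ≢ v) × ¬ Adj G u v
  ; adj?   = dec
  ; irrefl = λ { (u≢u , _) → u≢u refl }
  ; sym    = λ { (u≢v , ¬uv) → (λ e → u≢v (Relation.Binary.PropositionalEquality.sym e))
                              , (λ vu → ¬uv (Graph.sym G vu)) }
  }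
  where
  open import Data.Fin.Properties using (_≟_)
  open import Relation.Nullary using (yes; no)
  open import Relation.Nullary.Decidable using (_×-dec_; ¬?)
  dec : (u v : _) → Dec ((u ≢ v) × ¬ Adj G u v)
  dec u v = ¬? (u ≟ v) ×-dec ¬? (adj? G u v)

Distinct4 : ∀ {n} → Fin n → Fin n → Fin n → Fin n → Set
Distinct4 a b c d =
  (a ≢ b) × (a ≢ c) × (a ≢ d) × (b ≢ c) × (b ≢ d) × (c ≢ d)

InducedP4 : ∀ {n} → Graph n → Fin n → Fin n → Fin n → Fin n → Set
InducedP4 G a b c d = Distinct4 a b c d ×
  Adj G a b × Adj G b c × Adj G c d ×
  ¬ Adj G a c × ¬ Adj G a d × ¬ Adj G b d

InducedC4 : ∀ {n} → Graph n → Fin n → Fin n → Fin n → Fin n → Set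
InducedC4 G a b c d = Distinct4 a b c d ×
  Adj G a b × Adj G b c × Adj G c d × Adj G d a ×
  ¬ Adj G a c × ¬ Adj G b d

Induced2K2 : ∀ {n} → Graph n → Fin n → Fin n → Fin n → Fin n → Set
Induced2K2 G a b c d = Distinct4 a b c d ×
  Adj G a b × Adj G c d ×
  ¬ Adj G a c × ¬ Adj G a d × ¬ Adj G b c × ¬ Adj G b d

IsThreshold : ∀ {n} → Graph n → Set
IsThreshold G = ∀ a b c d →
  ¬ InducedP4 G a b c d × ¬ InducedC4 G a b c d × ¬ Induced2K2 G a b c d

Dominates : ∀ {n} → Graph n → Fin n → Fin n → Set
Dominates H u v = Adj H u v × (∀ w → Adj H v w → (w ≡ u) ⊎ Adj H u w)

NonTerminal : ∀ {n} → Graph n → Fin n → Set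
NonTerminal H t = ∃[ s ] (s ≢ t) × Dominates H t s

Terminal : ∀ {n} → Graph n → Fin n → Set
Terminal H t = ¬ NonTerminal H t

-- In a threshold graph open neighbourhoods are nested: for all x, y either
-- N(x) ∖ {y} ⊆ N(y) or N(y) ∖ {x} ⊆ N(x), since witnesses against both
-- inclusions would induce a P4, a C4 or a 2K2. Domination in A and in Ā are
-- both instances of such an inclusion, which gives the two adjacency claims.
-- For the equivalence: no vertex dominates in both A and Ā (true in every
-- graph). Conversely, if t has no non-neighbour it dominates any other
-- vertex; otherwise pick a non-neighbour m whose neighbourhood inside N(t)
-- is largest. If N(t) ⊆ N(m) then t Ā-dominates m; otherwise some y ∈ N(t)
-- misses m, so by maximality y has no neighbour outside N[t], and t
-- A-dominates y.
module Submission where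

open import Defs
open import Level using (Level)
open import Data.Nat using (ℕ; zero; suc; _>_; s≤s; z≤n)
open import Data.Fin using (Fin; zero; suc; punchIn)
open import Data.Fin.Properties using (_≟_; any?; punchInᵢ≢i)
open import Data.Product using (_×_; _,_; ∃-syntax; curry; proj₁; proj₂)
open import Data.Sum using (_⊎_; inj₁; inj₂; [_,_])
open import Data.Empty using (⊥; ⊥-elim)
open import Function using (_∘_)
open import Function.Bundles using (_⇔_; mk⇔)
open import Relation.Nullary using (¬_; Dec; yes; no)
open import Relation.Nullary.Decidable using (_×-dec_; ¬?; decidable-stable)
open import Relation.Unary using (Pred; Decidable)
open import Relation.Binary using (Rel; Reflexive; Transitive)
open import Relation.Binary.PropositionalEquality using (_≡_; _≢_; refl; ≢-sym)

private
  variable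
    p r : Level
    n : ℕ

⊆-or-witness : {P Q : Pred (Fin n) p} → Decidable P → Decidable Q →
               (∀ w → P w → Q w) ⊎ ∃[ w ] P w × ¬ Q w
⊆-or-witness P? Q? with any? (λ w → P? w ×-dec ¬? (Q? w))
... | yes witness = inj₂ witness
... | no ¬witness =
  inj₁ λ w pw → decidable-stable (Q? w) (λ ¬qw → ¬witness (w , pw , ¬qw))

greatest-or-empty : {P : Pred (Fin n) p} {_≤_ : Rel (Fin n) r} →
  Decidable P → Reflexive _≤_ → Transitive _≤_ →
  (∀ {x y} → P x → P y → x ≤ y ⊎ y ≤ x) →
  (∃[ m ] P m × ∀ x → P x → x ≤ m) ⊎ (∀ x → ¬ P x)
greatest-or-empty {zero} _ _ _ _ = inj₂ λ ()
greatest-or-empty {suc n} {P = P} {_≤_} P? ≤-refl ≤-trans total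
  with greatest-or-empty {P = P ∘ suc} {_≤_ = λ x y → suc x ≤ suc y}
                         (P? ∘ suc) ≤-refl ≤-trans total
     | P? zero
... | inj₂ none | no ¬p₀ = inj₂ λ { zero → ¬p₀ ; (suc x) → none x }
... | inj₂ none | yes p₀ =
  inj₁ (zero , p₀ , λ { zero _ → ≤-refl ; (suc x) px → ⊥-elim (none x px) })
... | inj₁ (m , pm , max) | no ¬p₀ =
  inj₁ (suc m , pm , λ { zero p₀ → ⊥-elim (¬p₀ p₀) ; (suc x) → max x })
... | inj₁ (m , pm , max) | yes p₀ with total p₀ pm
...   | inj₁ 0≤m = inj₁ (suc m , pm , λ { zero _ → 0≤m ; (suc x) → max x })
...   | inj₂ m≤0 =
  inj₁ (zero , p₀ , λ { zero _ → ≤-refl ; (suc x) px → ≤-trans (max x px) m≤0 })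

another-vertex : n > 1 → (t : Fin n) → ∃[ s ] s ≢ t
another-vertex (s≤s (s≤s z≤n)) t = punchIn t zero , punchInᵢ≢i t zero

NbhdIncluded : Graph n → Fin n → Fin n → Set
NbhdIncluded G x y = ∀ w → w ≢ y → Adj G x w → Adj G y w

NonNeighbour : Graph n → Fin n → Pred (Fin n) _
NonNeighbour G t x = x ≢ t × ¬ Adj G t x

_⊑⟨_,_⟩_ : Fin n → Graph n → Fin n → Fin n → Set
x ⊑⟨ G , t ⟩ y = ∀ w → Adj G t w → Adj G x w → Adj G y w

module _ (G : Graph n) where

  adj⇒≢ : ∀ {u v} → Adj G u v → u ≢ v
  adj⇒≢ uv refl = irrefl G uv

  included-or-escapes : ∀ x y →
    NbhdIncluded G x y ⊎ ∃[ w ] w ≢ y × Adj G x w × ¬ Adj G y w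
  included-or-escapes x y
    with ⊆-or-witness {P = λ w → w ≢ y × Adj G x w}
                      (λ w → ¬? (w ≟ y) ×-dec adj? G x w) (adj? G y)
  ... | inj₁ x⊆y = inj₁ (curry ∘ x⊆y)
  ... | inj₂ (w , (w≢y , xw) , ¬yw) = inj₂ (w , w≢y , xw , ¬yw)

  included⇒dominates : ∀ {t s} → Adj G t s → NbhdIncluded G s t →
                       Dominates G t s
  included⇒dominates {t} {s} ts s⊆t = ts , helper
    where
    helper : ∀ w → Adj G s w → (w ≡ t) ⊎ Adj G t w
    helper w sw with w ≟ t
    ... | yes w≡t = inj₁ w≡t
    ... | no w≢t = inj₂ (s⊆t w w≢t sw)

  included⇒co-dominates : ∀ {t x} → t ≢ x → ¬ Adj G t x →
    NbhdIncluded G t x → Dominates (complement G) t x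
  included⇒co-dominates {t} {x} t≢x ¬tx t⊆x = (t≢x , ¬tx) , helper
    where
    helper : ∀ w → Adj (complement G) x w → (w ≡ t) ⊎ Adj (complement G) t w
    helper w (x≢w , ¬xw) with w ≟ t
    ... | yes w≡t = inj₁ w≡t
    ... | no w≢t = inj₂ (≢-sym w≢t , ¬xw ∘ t⊆x w (≢-sym x≢w))

  -- If t dominates s in G and x in Ḡ, then s ∈ N(t) ∖ {x} ⊆ N(x) forces
  -- x ∈ N(s) ⊆ N[t], contradicting x ∉ N[t].
  ¬nonTerminal-in-both : ∀ {t} → NonTerminal G t →
                         ¬ NonTerminal (complement G) t
  ¬nonTerminal-in-both {t} (s , s≢t , ts , s⊆t) (x , x≢t , (_ , ¬tx) , x̄⊆t̄) =
    [ x≢t , ¬tx ] (s⊆t x (Graph.sym G xs))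
    where
    xs : Adj G x s
    xs = decidable-stable (adj? G x s) λ ¬xs →
      [ s≢t , (λ { (_ , ¬ts) → ¬ts ts }) ] (x̄⊆t̄ s ((λ { refl → ¬tx ts }) , ¬xs))

module Threshold (A : Graph n) (threshold : IsThreshold A) where

  ¬P4 : ∀ {a b c d} → ¬ InducedP4 A a b c d
  ¬P4 {a} {b} {c} {d} = proj₁ (threshold a b c d)

  ¬C4 : ∀ {a b c d} → ¬ InducedC4 A a b c d
  ¬C4 {a} {b} {c} {d} = proj₁ (proj₂ (threshold a b c d))

  ¬2K2 : ∀ {a b c d} → ¬ Induced2K2 A a b c d
  ¬2K2 {a} {b} {c} {d} = proj₂ (proj₂ (threshold a b c d))

  ¬crossing-escapes : ∀ {x y w z} →
    w ≢ y → Adj A x w → ¬ Adj A y w →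
    z ≢ x → Adj A y z → ¬ Adj A x z → ⊥
  ¬crossing-escapes {x} {y} {w} {z} w≢y xw ¬yw z≢x yz ¬xz =
    by-cases (adj? A x y) (adj? A w z)
    where
    x≢w : x ≢ w
    x≢w = adj⇒≢ A xw
    x≢z : x ≢ z
    x≢z = ≢-sym z≢x
    y≢z : y ≢ z
    y≢z = adj⇒≢ A yz
    z≢y : z ≢ y
    z≢y = ≢-sym y≢z
    x≢y : x ≢ y
    x≢y refl = ¬yw xw
    w≢z : w ≢ z
    w≢z refl = ¬yw yz
    ¬wy : ¬ Adj A w y
    ¬wy = ¬yw ∘ Graph.sym A
    by-cases : Dec (Adj A x y) → Dec (Adj A w z) → ⊥
    by-cases (yes xy) (yes wz) =
      ¬C4 ((x≢w , x≢z , x≢y , w≢z , w≢y , z≢y) ,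
           xw , wz , Graph.sym A yz , Graph.sym A xy , ¬xz , ¬wy)
    by-cases (yes xy) (no ¬wz) =
      ¬P4 ((≢-sym x≢w , w≢y , w≢z , x≢y , x≢z , y≢z) ,
           Graph.sym A xw , xy , yz , ¬wy , ¬wz , ¬xz)
    by-cases (no ¬xy) (yes wz) =
      ¬P4 ((x≢w , x≢z , x≢y , w≢z , w≢y , z≢y) ,
           xw , wz , Graph.sym A yz , ¬xz , ¬xy , ¬wy)
    by-cases (no ¬xy) (no ¬wz) =
      ¬2K2 ((x≢w , x≢y , x≢z , w≢y , w≢z , y≢z) ,
            xw , yz , ¬xy , ¬xz , ¬wy , ¬wz)

  nbhd-nested : ∀ x y → NbhdIncluded A x y ⊎ NbhdIncluded A y x
  nbhd-nested x y with included-or-escapes A x y | included-or-escapes A y x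
  ... | inj₁ x⊆y | _ = inj₁ x⊆y
  ... | inj₂ _ | inj₁ y⊆x = inj₂ y⊆x
  ... | inj₂ (w , w≢y , xw , ¬yw) | inj₂ (z , z≢x , yz , ¬xz) =
    ⊥-elim (¬crossing-escapes w≢y xw ¬yw z≢x yz ¬xz)

  greatest-nonNeighbour-or-none : ∀ t →
    (∃[ m ] NonNeighbour A t m × ∀ x → NonNeighbour A t x → x ⊑⟨ A , t ⟩ m) ⊎
    (∀ x → ¬ NonNeighbour A t x)
  greatest-nonNeighbour-or-none t =
    greatest-or-empty (λ x → ¬? (x ≟ t) ×-dec ¬? (adj? A t x))
                      (λ _ _ xw → xw) ⊑-trans ⊑-total
    where
    ⊑-trans : Transitive (_⊑⟨ A , t ⟩_)
    ⊑-trans x⊑y y⊑z w tw = y⊑z w tw ∘ x⊑y w tw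
    ⊑-total : ∀ {x y} → NonNeighbour A t x → NonNeighbour A t y →
              x ⊑⟨ A , t ⟩ y ⊎ y ⊑⟨ A , t ⟩ x
    ⊑-total {x} {y} (_ , ¬tx) (_ , ¬ty) with nbhd-nested x y
    ... | inj₁ x⊆y = inj₁ λ w tw → x⊆y w λ { refl → ¬ty tw }
    ... | inj₂ y⊆x = inj₂ λ w tw → y⊆x w λ { refl → ¬tx tw }

  nonTerminal-or-co-nonTerminal : n > 1 → ∀ t →
    NonTerminal A t ⊎ NonTerminal (complement A) t
  nonTerminal-or-co-nonTerminal n>1 t with greatest-nonNeighbour-or-none t
  ... | inj₂ none =
    let s , s≢t = another-vertex n>1 t in
    inj₁ (s , s≢t , included⇒dominates A (adjacent s s≢t) λ w w≢t _ → adjacent w w≢t)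
    where
    adjacent : ∀ w → w ≢ t → Adj A t w
    adjacent w w≢t = decidable-stable (adj? A t w) (curry (none w) w≢t)
  ... | inj₁ (m , (m≢t , ¬tm) , greatest) with ⊆-or-witness (adj? A t) (adj? A m)
  ...   | inj₁ t⊆m =
    inj₂ (m , m≢t , included⇒co-dominates A (≢-sym m≢t) ¬tm λ w _ → t⊆m w)
  ...   | inj₂ (y , ty , ¬my) =
    inj₁ (y , ≢-sym (adj⇒≢ A ty) , included⇒dominates A ty y⊆t)
    where
    y⊆t : NbhdIncluded A y t
    y⊆t w w≢t yw = decidable-stable (adj? A t w) λ ¬tw →
      ¬my (greatest w (w≢t , ¬tw) y ty (Graph.sym A yw))

  terminal⇔¬co-terminal : n > 1 → ∀ t →
    Terminal A t ⇔ (¬ Terminal (complement A) t)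
  terminal⇔¬co-terminal n>1 t = mk⇔
    (λ tA tĀ → [ tA , tĀ ] (nonTerminal-or-co-nonTerminal n>1 t))
    (λ ¬tĀ nA → ¬tĀ (¬nonTerminal-in-both A nA))

  terminals-nonadjacent : ∀ t t′ → Terminal A t → Terminal A t′ → ¬ Adj A t t′
  terminals-nonadjacent t t′ tA t′A tt′ with nbhd-nested t t′
  ... | inj₁ t⊆t′ =
    t′A (t , adj⇒≢ A tt′ , included⇒dominates A (Graph.sym A tt′) t⊆t′)
  ... | inj₂ t′⊆t =
    tA (t′ , ≢-sym (adj⇒≢ A tt′) , included⇒dominates A tt′ t′⊆t)

  nonTerminals-adjacent : ∀ t t′ → t ≢ t′ →
    NonTerminal A t → NonTerminal A t′ → Adj A t t′
  nonTerminals-adjacent t t′ t≢t′ nA n′A =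
    decidable-stable (adj? A t t′) λ ¬tt′ → co-dominated ¬tt′ (nbhd-nested t t′)
    where
    co-dominated : ¬ Adj A t t′ → NbhdIncluded A t t′ ⊎ NbhdIncluded A t′ t → ⊥
    co-dominated ¬tt′ (inj₁ t⊆t′) =
      ¬nonTerminal-in-both A nA
        (t′ , ≢-sym t≢t′ , included⇒co-dominates A t≢t′ ¬tt′ t⊆t′)
    co-dominated ¬tt′ (inj₂ t′⊆t) =
      ¬nonTerminal-in-both A n′A
        (t , t≢t′ , included⇒co-dominates A (≢-sym t≢t′) (¬tt′ ∘ Graph.sym A) t′⊆t)

mainTheorem14 : ∀ {n} (A : Graph n) → IsThreshold A → n > 1 →
    (∀ t → Terminal A t ⇔ (¬ Terminal (complement A) t)) ×
    (∀ t t′ → Terminal A t → Terminal A t′ → ¬ Adj A t t′) ×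
    (∀ t t′ → t ≢ t′ → NonTerminal A t → NonTerminal A t′ → Adj A t t′)
mainTheorem14 A threshold n>1 =
  terminal⇔¬co-terminal n>1 , terminals-nonadjacent , nonTerminals-adjacent
  where open Threshold A threshold
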